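{- For a mixed graph $G$ let $\Theta(G)=\sum_{G'\in\mathcal{O}_{ac}(G)}G'$ (zero if $\mathcal{O}_{ac}(G)=\emptyset$). Then $\Theta$ is a morphism of double twisted bialgebras from $\mathbf{G}$ to $\mathbf{G}_{aco}$; that is, for all finite sets: $\Theta(GH)=\Theta(G)\Theta(H)$ for mixed graphs $G,H$ on disjoint vertex sets and $\Theta(1)=1$; $(\Theta\otimes\Theta)\circ\Delta_{I,J}(G)=\Delta_{I,J}\circ\Theta(G)$ for every mixed graph $G$ with $V(G)=I\sqcup J$; $(\Theta\otimes\Theta)\circ\delta_\sim(G)=\delta^{ac}_\sim\circ\Theta(G)$ for every mixed graph $G$ and every equivalence $\sim$ on $V(G)$; and $\Theta$ is compatible with the counits.
   Context: A mixed graph $G$ has a finite vertex set $V(G)$, edges $E(G)$ (2-element subsets) and arcs $A(G)$ (ordered pairs of distinct vertices), no pair being both an edge and carrying an arc; it is oriented if $E(G)=\emptyset$, and acyclic if it has no oriented cycle $x_0\to\cdots\to x_n=x_0$, $n\geq2$, along arcs. An orientation of $G$ is an oriented graph $H$ with $V(H)=V(G)$ and $A(H)=A(G)\sqcup E'$, where $E'$ contains, for each edge $\{x,y\}\in E(G)$, exactly one of $(x,y),(y,x)$; $\mathcal{O}_{ac}(G)$ is the set of acyclic orientations. $\mathbf{G}[X]$ (resp. $\mathbf{G}_{aco}[X]$) is spanned by mixed graphs (resp. acyclic oriented graphs) with vertex set $X$. Product: disjoint union. $\Delta_{I,J}(G)=G_{\mid I}\otimes G_{\mid J}$ if $J$ is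 an ideal of $G$ (i.e. $y\in J$, $(y,z)\in A(G)\Rightarrow z\in J$), $0$ otherwise. $\mathcal{E}^c[G]$: equivalences whose classes induce connected subgraphs (ignoring orientation). $G\mid\sim$ keeps only edges/arcs inside classes; $G/\sim$ has the classes as vertices, arcs $(\mathrm{cl}(x),\mathrm{cl}(y))$ for arcs $(x,y)$ between distinct classes, and edges between distinct classes coming from edges of $G$ when no arc of $G/\sim$ joins them. On $\mathbf{G}$: $\delta_\sim(G)=G/\sim\otimes G\mid\sim$ if $\sim\in\mathcal{E}^c[G]$, else $0$. On $\mathbf{G}_{aco}$: $\delta^{ac}_\sim(H)=H/\sim\otimes H\mid\sim$ if $\sim\in\mathcal{E}^c[H]$ and $H/\sim$ is acyclic, else $0$. Counits: $\varepsilon_\Delta(1)=1$; $\epsilon_\delta(G)=1$ if $E(G)=A(G)=\emptyset$, else $0$. -}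

module Defs where

open import Level using (Level; suc; zero)
open import Data.Nat as ℕ using (ℕ; _≤_)
open import Data.Bool using (Bool; true; false; _∧_; _∨_; not)
open import Data.Fin using (Fin; _≟_)
open import Data.Vec using (Vec; lookup; tabulate; replicate)
open import Data.Product using (Σ; _×_; _,_)
open import Data.Sum using (_⊎_)
open import Data.Unit using (⊤; tt)
open import Data.Empty using (⊥)
open import Data.Irrelevant using (Irrelevant)
open import Relation.Nullary using (¬_; does)
open import Relation.Binary.PropositionalEquality using (_≡_)
open import Function.Bundles using (_↔_; Inverse)

-- Binary relations on Fin N: Boolean N×N matrices (canonical data, so
-- propositional equality of graphs is the right equality of basis elements).

VSet : ℕ → Set
VSet N = Vec Bool N

Mat : ℕ → Set
Mat N = Vec (Vec Bool N) N

mat : ∀ {N} → (Fin N → Fin N → Bool) → Mat N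
mat f = tabulate (λ x → tabulate (λ y → f x y))

at : ∀ {N} → Mat N → Fin N → Fin N → Bool
at M x y = lookup (lookup M x) y

emptyMat : ∀ {N} → Mat N
emptyMat = replicate _ (replicate _ false)

emptySet : ∀ {N} → VSet N
emptySet = replicate _ false

_∈_ : ∀ {N} → Fin N → VSet N → Set
x ∈ X = lookup X x ≡ true

_==_ : ∀ {N} → Fin N → Fin N → Bool
x == y = does (x ≟ y)

anyF : ∀ {N} → (Fin N → Bool) → Bool
anyF {ℕ.zero} f = false
anyF {ℕ.suc N} f = f Fin.zero ∨ anyF (λ i → f (Fin.suc i))

-- Mixed graphs with vertex set a subset of Fin N.
--  E ! x ! y = true  iff {x,y} is an edge;  A ! x ! y = true iff (x,y) is an arc.

record MG (N : ℕ) : Set where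
  constructor mg
  field
    V : VSet N
    E : Mat N
    A : Mat N
open MG public

Edge : ∀ {N} → MG N → Fin N → Fin N → Set
Edge G x y = (at (E G) x y) ≡ true

Arc : ∀ {N} → MG N → Fin N → Fin N → Set
Arc G x y = (at (A G) x y) ≡ true

record WF {N} (G : MG N) : Set where
  field
    E-sym   : ∀ x y → (at (E G) x y) ≡ (at (E G) y x)
    E-irr   : ∀ x → ¬ Edge G x x
    A-irr   : ∀ x → ¬ Arc G x x
    E-dom   : ∀ x y → Edge G x y → x ∈ V G × y ∈ V G
    A-dom   : ∀ x y → Arc G x y → x ∈ V G × y ∈ V G
    E-A     : ∀ x y → Edge G x y → ¬ Arc G x y

Oriented : ∀ {N} → MG N → Set
Oriented G = E G ≡ emptyMat

data Walk {N} (H : MG N) : Fin N → Fin N → ℕ → Set where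
  stop : ∀ {x} → Walk H x x 0
  step : ∀ {x y z n} → Arc H x y → Walk H y z n → Walk H x z (ℕ.suc n)

Acyclic : ∀ {N} → MG N → Set
Acyclic H = ∀ x n → 2 ≤ n → ¬ Walk H x x n

record IsOrientation {N} (G H : MG N) : Set where
  field
    sameV   : V H ≡ V G
    noEdges : Oriented H
    keepArc : ∀ x y → Arc G x y → Arc H x y
    newArc  : ∀ x y → Arc H x y → Arc G x y ⊎ Edge G x y
    orient  : ∀ x y → Edge G x y →
              (Arc H x y × ¬ Arc H y x) ⊎ (¬ Arc H x y × Arc H y x)

IsAcyclicOrientation : ∀ {N} → MG N → MG N → Set
IsAcyclicOrientation G H = IsOrientation G H × Acyclic H

_·_ : ∀ {N} → MG N → MG N → MG N
G · H = mg (tabulate (λ x → lookup (V G) x ∨ lookup (V H) x))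
           (mat (λ x y → (at (E G) x y) ∨ (at (E H) x y)))
           (mat (λ x y → (at (A G) x y) ∨ (at (A H) x y)))

emptyGraph : ∀ {N} → MG N
emptyGraph = mg emptySet emptyMat emptyMat

restrict : ∀ {N} → MG N → VSet N → MG N
restrict G I = mg I
  (mat (λ x y → (at (E G) x y) ∧ lookup I x ∧ lookup I y))
  (mat (λ x y → (at (A G) x y) ∧ lookup I x ∧ lookup I y))

IsIdeal : ∀ {N} → VSet N → MG N → Set
IsIdeal J G = ∀ y z → y ∈ J → Arc G y z → z ∈ J

-- Equivalences on V(G) are presented by a representative map r:
-- x ∼ y iff r x ≡ r y; the class of x is labelled by its representative r x.
record Represents {N} (G : MG N) (r : Fin N → Fin N) : Set where
  field
    rep-in  : ∀ x → x ∈ V G → r x ∈ V G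
    rep-idem : ∀ x → x ∈ V G → r (r x) ≡ r x

Adj : ∀ {N} → MG N → Fin N → Fin N → Set
Adj G x y = Edge G x y ⊎ Arc G x y ⊎ Arc G y x

data Linked {N} (G : MG N) (P : Fin N → Set) : Fin N → Fin N → Set where
  here : ∀ {x} → Linked G P x x
  hop  : ∀ {x y z} → P y → Adj G x y → Linked G P y z → Linked G P x z

ConnClasses : ∀ {N} → MG N → (Fin N → Fin N) → Set
ConnClasses G r = ∀ x y → x ∈ V G → y ∈ V G → r x ≡ r y →
  Linked G (λ z → z ∈ V G × r z ≡ r x) x y

inner : ∀ {N} → MG N → (Fin N → Fin N) → MG N
inner G r = mg (V G)
  (mat (λ x y → (at (E G) x y) ∧ (r x == r y)))
  (mat (λ x y → (at (A G) x y) ∧ (r x == r y)))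

quotArc : ∀ {N} → MG N → (Fin N → Fin N) → Fin N → Fin N → Bool
quotArc G r a b = not (a == b) ∧
  anyF (λ x → anyF (λ y → (at (A G) x y) ∧ (r x == a) ∧ (r y == b)))

quotEdge : ∀ {N} → MG N → (Fin N → Fin N) → Fin N → Fin N → Bool
quotEdge G r a b = not (a == b) ∧
  anyF (λ x → anyF (λ y → (at (E G) x y) ∧ (r x == a) ∧ (r y == b))) ∧
  not (quotArc G r a b) ∧ not (quotArc G r b a)

quot : ∀ {N} → MG N → (Fin N → Fin N) → MG N
quot G r = mg (tabulate (λ a → lookup (V G) a ∧ (r a == a)))
  (mat (quotEdge G r)) (mat (quotArc G r))

-- Formal sums (linear combinations with coefficients in ℕ) of basis
-- elements of type B: a family of basis elements indexed by a type.
-- Two formal sums are equal iff their index types are in bijection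
-- compatibly with the basis elements (i.e. same multiplicities).

record FSum (B : Set) : Set₁ where
  constructor fsum
  field
    Idx  : Set
    term : Idx → B
open FSum public

record _≋_ {B : Set} (S T : FSum B) : Set where
  field
    bij  : Idx S ↔ Idx T
    resp : ∀ i → term T (Inverse.to bij i) ≡ term S i

single : ∀ {B} → B → FSum B
single b = fsum ⊤ (λ _ → b)

-- "b if P holds, else 0"
when : ∀ {B} → Set → B → FSum B
when P b = fsum (Irrelevant P) (λ _ → b)

bind : ∀ {B C} → FSum B → (B → FSum C) → FSum C
bind S f = fsum (Σ (Idx S) (λ i → Idx (f (term S i))))
                (λ { (i , j) → term (f (term S i)) j })

bilin : ∀ {B C D} → (B → C → D) → FSum B → FSum C → FSum D
bilin f S T = fsum (Idx S × Idx T) (λ { (i , j) → f (term S i) (term T j) })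

_⋆_ : ∀ {N} → FSum (MG N) → FSum (MG N) → FSum (MG N)
S ⋆ T = bilin _·_ S T

_⊗_ : ∀ {B C} → FSum B → FSum C → FSum (B × C)
S ⊗ T = bilin _,_ S T

Θ : ∀ {N} → MG N → FSum (MG N)
Θ G = fsum (Σ (MG _) (λ H → Irrelevant (IsAcyclicOrientation G H)))
           (λ { (H , _) → H })

Θ⊗Θ : ∀ {N} → FSum (MG N × MG N) → FSum (MG N × MG N)
Θ⊗Θ S = bind S (λ { (G , H) → Θ G ⊗ Θ H })

DisjointUnion : ∀ {N} → VSet N → VSet N → VSet N → Set
DisjointUnion I J X = ∀ x → (x ∈ X → x ∈ I ⊎ x ∈ J) × (x ∈ I → x ∈ X) ×
                            (x ∈ J → x ∈ X) × ¬ (x ∈ I × x ∈ J)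

Δ : ∀ {N} → VSet N → VSet N → MG N → FSum (MG N × MG N)
Δ I J G = when (IsIdeal J G) (restrict G I , restrict G J)

δ : ∀ {N} → (Fin N → Fin N) → MG N → FSum (MG N × MG N)
δ r G = when (ConnClasses G r) (quot G r , inner G r)

δac : ∀ {N} → (Fin N → Fin N) → MG N → FSum (MG N × MG N)
δac r H = when (ConnClasses H r × Acyclic (quot H r)) (quot H r , inner H r)

-- counits, as formal sums over the one-element basis ⊤ of the scalars
εΔ : ∀ {N} → MG N → FSum ⊤
εΔ G = when (V G ≡ emptySet) tt

εδ : ∀ {N} → MG N → FSum ⊤
εδ G = when (E G ≡ emptyMat × A G ≡ emptyMat) tt

-- An acyclic orientation of a disjoint union is a pair of acyclic orientations of the two
-- parts. If J is an ideal of G, an acyclic orientation H of G in which J is still an ideal must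
-- direct every edge between I and J from I to J, so H is determined by H|I and H|J; conversely,
-- gluing acyclic orientations of G|I and G|J in this way creates no cycle, because a walk that
-- enters J never leaves it. Likewise an acyclic orientation H of G with H/∼ acyclic is determined
-- by H/∼ and H|∼: an edge between two classes is directed like the arc of H/∼ joining them, and a
-- cycle of the glued graph either stays inside one class or projects to a cycle of H/∼.
-- Connectedness of the classes depends only on the underlying undirected graph, which an
-- orientation does not change. For the counits: a graph without edges and arcs has exactly one
-- orientation.

module Submission where

open import Defs
open import Data.Nat using (ℕ; zero; suc; s≤s; z≤n)
open import Data.Bool using (Bool; true; false; _∧_; _∨_; not)
open import Data.Fin using (Fin; _≟_)
open import Data.Vec using (Vec; lookup; tabulate)
open import Data.Vec.Properties using (≡-dec; lookup-replicate; lookup∘tabulate; tabulate∘lookup; tabulate-cong)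
import Data.Bool.Properties as Bool
open import Data.Product as Product using (Σ; ∃; ∃₂; _×_; _,_; proj₁; proj₂)
open import Data.Product.Function.NonDependent.Propositional using (_×-⇔_)
open import Data.Sum as Sum using (_⊎_; inj₁; inj₂; [_,_]′)
open import Data.Sum.Function.Propositional using (_⊎-⇔_)
open import Data.Unit using (tt)
open import Data.Empty using (⊥; ⊥-elim)
open import Data.Irrelevant using (Irrelevant; [_])
open import Function using (id; _∘_)
open import Function.Bundles using (_⇔_; mk⇔; Equivalence; mk↔ₛ′)
open import Function.Construct.Identity using (⇔-id)
open import Function.Construct.Composition using (_⇔-∘_)
open import Function.Construct.Symmetry using (⇔-sym)
open import Relation.Nullary using (¬_; Dec; yes; no)
open import Relation.Nullary.Recomputable using (Recomputable)
open import Relation.Nullary.Decidable using (recompute; map′; _×-dec_)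
open import Relation.Binary.Definitions using (DecidableEquality)
open import Function.Related.TypeIsomorphisms using (¬-cong-⇔)
open import Relation.Binary.PropositionalEquality

open Equivalence using (to; from)

∧-true : ∀ {a b} → a ∧ b ≡ true ⇔ (a ≡ true × b ≡ true)
∧-true {true}  = mk⇔ (refl ,_) proj₂
∧-true {false} = mk⇔ (λ ()) (λ { (() , _) })

∨-true : ∀ {a b} → a ∨ b ≡ true ⇔ (a ≡ true ⊎ b ≡ true)
∨-true {true}  = mk⇔ inj₁ (λ _ → refl)
∨-true {false} = mk⇔ inj₂ [ (λ ()) , id ]′

not-true : ∀ {a} → not a ≡ true ⇔ (¬ a ≡ true)
not-true {true}  = mk⇔ (λ ()) (λ ¬t → ⊥-elim (¬t refl))
not-true {false} = mk⇔ (λ _ ()) (λ _ → refl)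

==-true : ∀ {N} {x y : Fin N} → x == y ≡ true ⇔ x ≡ y
==-true {x = x} {y} with x ≟ y
... | yes x≡y = mk⇔ (λ _ → x≡y) (λ _ → refl)
... | no  x≢y = mk⇔ (λ ()) (⊥-elim ∘ x≢y)

anyF-true : ∀ {N} {f : Fin N → Bool} → anyF f ≡ true ⇔ ∃ λ i → f i ≡ true
anyF-true = mk⇔ witness search
  where
  witness : ∀ {N} {f : Fin N → Bool} → anyF f ≡ true → ∃ λ i → f i ≡ true
  witness {suc N} {f} p with to (∨-true {f Fin.zero}) p
  ... | inj₁ f0 = Fin.zero , f0
  ... | inj₂ rest with witness rest
  ... | i , fi = Fin.suc i , fi
  search : ∀ {N} {f : Fin N → Bool} → (∃ λ i → f i ≡ true) → anyF f ≡ true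
  search (Fin.zero , f0) = from ∨-true (inj₁ f0)
  search {f = f} (Fin.suc i , fi) = from (∨-true {f Fin.zero}) (inj₂ (search (i , fi)))

bool-ext : ∀ {a b : Bool} → (a ≡ true ⇔ b ≡ true) → a ≡ b
bool-ext {false} {false} _ = refl
bool-ext {false} {true}  a⇔b = from a⇔b refl
bool-ext {true}  {false} a⇔b = sym (to a⇔b refl)
bool-ext {true}  {true}  _ = refl

at-mat : ∀ {N} (f : Fin N → Fin N → Bool) x y → at (mat f) x y ≡ f x y
at-mat f x y = trans (cong (λ row → lookup row y) (lookup∘tabulate _ x)) (lookup∘tabulate (f x) y)

mat-true : ∀ {N} (f : Fin N → Fin N → Bool) {x y} → at (mat f) x y ≡ true ⇔ f x y ≡ true
mat-true f {x} {y} = mk⇔ (trans (sym (at-mat f x y))) (trans (at-mat f x y))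

emptyMat-false : ∀ {N} (x y : Fin N) → ¬ at emptyMat x y ≡ true
emptyMat-false x y p
  with () ← trans (sym (trans (cong (λ row → lookup row y) (lookup-replicate x _)) (lookup-replicate y false))) p

emptySet-false : ∀ {N} {x : Fin N} → ¬ x ∈ emptySet
emptySet-false {x = x} p with () ← trans (sym (lookup-replicate x false)) p

vec-ext : ∀ {A : Set} {n} {v w : Vec A n} → (∀ i → lookup v i ≡ lookup w i) → v ≡ w
vec-ext {v = v} {w} v≗w = trans (sym (tabulate∘lookup v)) (trans (tabulate-cong v≗w) (tabulate∘lookup w))

mat-ext : ∀ {N} {M M' : Mat N} → (∀ x y → at M x y ≡ true ⇔ at M' x y ≡ true) → M ≡ M'
mat-ext M⇔M' = vec-ext (λ x → vec-ext (λ y → bool-ext (M⇔M' x y)))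

mat-cong : ∀ {N} {f g : Fin N → Fin N → Bool} → (∀ x y → f x y ≡ g x y) → mat f ≡ mat g
mat-cong f≗g = tabulate-cong (λ x → tabulate-cong (f≗g x))

emptyMat-unique : ∀ {N} {M : Mat N} → (∀ x y → ¬ at M x y ≡ true) → M ≡ emptyMat
emptyMat-unique M-false = mat-ext (λ x y → mk⇔ (⊥-elim ∘ M-false x y) (⊥-elim ∘ emptyMat-false x y))

MG-≡ : ∀ {N} {G H : MG N} → V G ≡ V H → E G ≡ E H → A G ≡ A H → G ≡ H
MG-≡ refl refl refl = refl

MG-≟ : ∀ {N} → DecidableEquality (MG N)
MG-≟ G H = map′ (λ (v , e , a) → MG-≡ v e a) (λ G≡H → cong V G≡H , cong E G≡H , cong A G≡H)
                (≡-dec Bool._≟_ (V G) (V H) ×-dec mat-≟ (E G) (E H) ×-dec mat-≟ (A G) (A H))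
  where mat-≟ = ≡-dec (≡-dec Bool._≟_)

-- Indices of formal sums carry their proofs irrelevantly; since equality of graphs is decidable,
-- equations derived from such proofs can be recomputed relevantly.
MG-recompute : ∀ {N} {G H : MG N} → Recomputable (G ≡ H)
MG-recompute {G = G} {H} = recompute (MG-≟ G H)

oriented-ext : ∀ {N} {G H : MG N} → V G ≡ V H → Oriented G → Oriented H →
               (∀ x y → Arc G x y ⇔ Arc H x y) → G ≡ H
oriented-ext v≡ oG oH arcs = MG-≡ v≡ (trans oG (sym oH)) (mat-ext arcs)

orientation-no-edge : ∀ {N} {G H : MG N} → IsOrientation G H → ∀ x y → ¬ Edge H x y
orientation-no-edge o x y e = emptyMat-false x y (subst (λ M → at M x y ≡ true) (IsOrientation.noEdges o) e)

Arc? : ∀ {N} (K : MG N) x y → Dec (Arc K x y)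
Arc? K x y = at (A K) x y Bool.≟ true

Joins : ∀ {N} → (Fin N → Fin N → Set) → (Fin N → Fin N) → Fin N → Fin N → Set
Joins R r a b = ∃₂ λ x y → R x y × r x ≡ a × r y ≡ b

joins-true : ∀ {N} {M : Mat N} {r : Fin N → Fin N} {a b} →
  anyF (λ x → anyF (λ y → at M x y ∧ (r x == a) ∧ (r y == b))) ≡ true ⇔
  Joins (λ x y → at M x y ≡ true) r a b
joins-true {M = M} {r} {a} {b} = mk⇔ out into
  where
  entry : ∀ {x y} → (at M x y ∧ (r x == a) ∧ (r y == b)) ≡ true ⇔
                    (at M x y ≡ true × r x ≡ a × r y ≡ b)
  entry = (⇔-id _ ×-⇔ ((==-true ×-⇔ ==-true) ⇔-∘ ∧-true)) ⇔-∘ ∧-true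
  out : anyF (λ x → anyF (λ y → at M x y ∧ (r x == a) ∧ (r y == b))) ≡ true →
        Joins (λ x y → at M x y ≡ true) r a b
  out p with to anyF-true p
  ... | x , px with to anyF-true px
  ... | y , pxy = x , y , to entry pxy
  into : Joins (λ x y → at M x y ≡ true) r a b →
         anyF (λ x → anyF (λ y → at M x y ∧ (r x == a) ∧ (r y == b))) ≡ true
  into (x , y , j) = from anyF-true (x , from anyF-true (y , from entry j))

module _ {N : ℕ} {x y : Fin N} where

  Arc-· : (G H : MG N) → Arc (G · H) x y ⇔ (Arc G x y ⊎ Arc H x y)
  Arc-· G H = ∨-true ⇔-∘ mat-true (λ x y → at (A G) x y ∨ at (A H) x y)

  Edge-· : (G H : MG N) → Edge (G · H) x y ⇔ (Edge G x y ⊎ Edge H x y)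
  Edge-· G H = ∨-true ⇔-∘ mat-true (λ x y → at (E G) x y ∨ at (E H) x y)

  Arc-restrict : (G : MG N) (P : VSet N) → Arc (restrict G P) x y ⇔ (Arc G x y × x ∈ P × y ∈ P)
  Arc-restrict G P = ((⇔-id _ ×-⇔ ∧-true) ⇔-∘ ∧-true)
    ⇔-∘ mat-true (λ x y → at (A G) x y ∧ lookup P x ∧ lookup P y)

  Edge-restrict : (G : MG N) (P : VSet N) → Edge (restrict G P) x y ⇔ (Edge G x y × x ∈ P × y ∈ P)
  Edge-restrict G P = ((⇔-id _ ×-⇔ ∧-true) ⇔-∘ ∧-true)
    ⇔-∘ mat-true (λ x y → at (E G) x y ∧ lookup P x ∧ lookup P y)

  Arc-inner : (G : MG N) (r : Fin N → Fin N) → Arc (inner G r) x y ⇔ (Arc G x y × r x ≡ r y)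
  Arc-inner G r = ((⇔-id _ ×-⇔ ==-true) ⇔-∘ ∧-true)
    ⇔-∘ mat-true (λ x y → at (A G) x y ∧ (r x == r y))

  Edge-inner : (G : MG N) (r : Fin N → Fin N) → Edge (inner G r) x y ⇔ (Edge G x y × r x ≡ r y)
  Edge-inner G r = ((⇔-id _ ×-⇔ ==-true) ⇔-∘ ∧-true)
    ⇔-∘ mat-true (λ x y → at (E G) x y ∧ (r x == r y))

not==-true : ∀ {N} {a b : Fin N} → not (a == b) ≡ true ⇔ (¬ a ≡ b)
not==-true = ¬-cong-⇔ ==-true ⇔-∘ not-true

module _ {N : ℕ} (G : MG N) (r : Fin N → Fin N) {a b : Fin N} where

  Arc-quot : Arc (quot G r) a b ⇔ (¬ a ≡ b × Joins (Arc G) r a b)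
  Arc-quot = ((not==-true ×-⇔ joins-true {M = A G}) ⇔-∘ ∧-true) ⇔-∘ mat-true (quotArc G r)

  Edge-quot : Edge (quot G r) a b ⇔
    (¬ a ≡ b × Joins (Edge G) r a b × ¬ Arc (quot G r) a b × ¬ Arc (quot G r) b a)
  Edge-quot =
    ((not==-true ×-⇔ ((joins-true {M = E G} ×-⇔ ((¬quotArc ×-⇔ ¬quotArc) ⇔-∘ ∧-true)) ⇔-∘ ∧-true))
     ⇔-∘ ∧-true) ⇔-∘ mat-true (quotEdge G r)
    where
    ¬quotArc : ∀ {c d} → not (quotArc G r c d) ≡ true ⇔ (¬ Arc (quot G r) c d)
    ¬quotArc = ¬-cong-⇔ (⇔-sym (mat-true (quotArc G r))) ⇔-∘ not-true

walk-map : ∀ {N} {H H' : MG N} → (∀ {x y} → Arc H x y → Arc H' x y) →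
           ∀ {x z n} → Walk H x z n → Walk H' x z n
walk-map f stop       = stop
walk-map f (step a w) = step (f a) (walk-map f w)

acyclic-antimono : ∀ {N} {H H' : MG N} → (∀ {x y} → Arc H x y → Arc H' x y) → Acyclic H' → Acyclic H
acyclic-antimono f acyclic x n 2≤n w = acyclic x n 2≤n (walk-map f w)

arcless-acyclic : ∀ {N} {H : MG N} → (∀ x y → ¬ Arc H x y) → Acyclic H
arcless-acyclic noArc x _ 2≤n (step a _) = noArc _ _ a

acyclic-asym : ∀ {N} {H : MG N} {a b} → Acyclic H → Arc H a b → ¬ Arc H b a
acyclic-asym {a = a} acyclic ab ba = acyclic a 2 (s≤s (s≤s z≤n)) (step ab (step ba stop))

Σ-irrelevant-≡ : ∀ {B : Set} {P : B → Set} {a b : B} {p : Irrelevant (P a)} {q : Irrelevant (P b)} →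
                 a ≡ b → _≡_ {A = Σ B (λ c → Irrelevant (P c))} (a , p) (b , q)
Σ-irrelevant-≡ refl = refl

Edgeless : ∀ {N} → MG N → Set
Edgeless G = E G ≡ emptyMat × A G ≡ emptyMat

discrete : ∀ {N} → MG N → MG N
discrete G = mg (V G) emptyMat emptyMat

module _ {N : ℕ} {G : MG N} where

  discrete-isAcyclicOrientation : Edgeless G → IsAcyclicOrientation G (discrete G)
  discrete-isAcyclicOrientation (noE , noA) =
    record { sameV   = refl
           ; noEdges = refl
           ; keepArc = λ x y a → ⊥-elim (emptyMat-false x y (subst (λ M → at M x y ≡ true) noA a))
           ; newArc  = λ x y a → ⊥-elim (emptyMat-false x y a)
           ; orient  = λ x y e → ⊥-elim (emptyMat-false x y (subst (λ M → at M x y ≡ true) noE e)) }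
    , arcless-acyclic emptyMat-false

  edgeless-orientation-unique : ∀ {H} → Edgeless G → IsOrientation G H → H ≡ discrete G
  edgeless-orientation-unique (noE , noA) o =
    oriented-ext sameV noEdges refl
      (λ x y → mk⇔ (⊥-elim ∘ [ noArcG x y , noEdgeG x y ]′ ∘ newArc x y) (⊥-elim ∘ emptyMat-false x y))
    where
    open IsOrientation o
    noArcG : ∀ x y → ¬ Arc G x y
    noArcG x y a = emptyMat-false x y (subst (λ M → at M x y ≡ true) noA a)
    noEdgeG : ∀ x y → ¬ Edge G x y
    noEdgeG x y e = emptyMat-false x y (subst (λ M → at M x y ≡ true) noE e)

  Θ-edgeless : Edgeless G → Θ G ≋ single (discrete G)
  Θ-edgeless edgeless = record
    { bij  = mk↔ₛ′ (λ _ → tt) (λ _ → discrete G , [ discrete-isAcyclicOrientation edgeless ])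
                   (λ _ → refl) (λ { (H , [ o ]) → Σ-irrelevant-≡ (unique o) })
    ; resp = λ { (H , [ o ]) → unique o } }
    where
    unique : ∀ {H} → .(IsAcyclicOrientation G H) → discrete G ≡ H
    unique o = MG-recompute (sym (edgeless-orientation-unique edgeless (proj₁ o)))

  bind-Θ-when : (P : MG N → Set) → (∀ {H} → IsOrientation G H → P H → P G) →
                (P G → Edgeless G) → (P G → P (discrete G)) →
                bind (Θ G) (λ H → when (P H) tt) ≋ when (P G) tt
  bind-Θ-when P reflect edgeless discreteP = record
    { bij  = mk↔ₛ′ (λ { ((H , [ o ]) , [ pH ]) → [ reflect (proj₁ o) pH ] })
                   (λ { [ pG ] → (discrete G , [ discrete-isAcyclicOrientation (edgeless pG) ]) , [ discreteP pG ] })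
                   (λ _ → refl)
                   (λ { ((H , [ o ]) , [ pH ]) →
                        Σ-irrelevant-≡ (Σ-irrelevant-≡ (MG-recompute (sym (edgeless-orientation-unique
                                         (edgeless (reflect (proj₁ o) pH)) (proj₁ o))))) })
    ; resp = λ _ → refl }

  edgeless-reflect : ∀ {H} → IsOrientation G H → Edgeless H → Edgeless G
  edgeless-reflect {H} o (_ , noA) =
    emptyMat-unique (λ x y → [ noArcH ∘ proj₁ , noArcH ∘ proj₂ ]′ ∘ orient x y) ,
    emptyMat-unique (λ x y → noArcH ∘ keepArc x y)
    where
    open IsOrientation o
    noArcH : ∀ {x y} → ¬ Arc H x y
    noArcH {x} {y} a = emptyMat-false x y (subst (λ M → at M x y ≡ true) noA a)

  vertexless-edgeless : WF G → V G ≡ emptySet → Edgeless G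
  vertexless-edgeless wf noV =
    emptyMat-unique (λ x y → noVertex ∘ proj₁ ∘ E-dom x y) ,
    emptyMat-unique (λ x y → noVertex ∘ proj₁ ∘ A-dom x y)
    where
    open WF wf
    noVertex : ∀ {x} → ¬ x ∈ V G
    noVertex {x} = emptySet-false {x = x} ∘ subst (λ X → x ∈ X) noV

  bind-Θ-εδ : bind (Θ G) εδ ≋ εδ G
  bind-Θ-εδ = bind-Θ-when Edgeless edgeless-reflect id (λ _ → refl , refl)

  bind-Θ-εΔ : WF G → bind (Θ G) εΔ ≋ εΔ G
  bind-Θ-εΔ wf = bind-Θ-when (λ H → V H ≡ emptySet) (λ o noV → trans (sym (IsOrientation.sameV o)) noV)
                             (vertexless-edgeless wf) id

ExactlyOneArc : ∀ {N} → MG N → Fin N → Fin N → Set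
ExactlyOneArc H x y = (Arc H x y × ¬ Arc H y x) ⊎ (¬ Arc H x y × Arc H y x)

ExactlyOneArc-cong : ∀ {N} {H H' : MG N} {a b x y} → (Arc H a b ⇔ Arc H' x y) → (Arc H b a ⇔ Arc H' y x) →
                     ExactlyOneArc H a b → ExactlyOneArc H' x y
ExactlyOneArc-cong xy yx (inj₁ (a , ¬b)) = inj₁ (to xy a , ¬b ∘ from yx)
ExactlyOneArc-cong xy yx (inj₂ (¬a , b)) = inj₂ (¬a ∘ from xy , to yx b)

Disjoint : ∀ {N} → VSet N → VSet N → Set
Disjoint X Y = ∀ x → x ∈ X → x ∈ Y → ⊥

module _ {N : ℕ} {G H : MG N} where

  orientation-arc-support : WF G → IsOrientation G H → ∀ {x y} → Arc H x y → x ∈ V G × y ∈ V G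
  orientation-arc-support wf o {x} {y} = [ A-dom x y , E-dom x y ]′ ∘ IsOrientation.newArc o x y
    where open WF wf

  orientation-WF : WF G → IsOrientation G H → WF H
  orientation-WF wf o = record
    { E-sym = λ x y → bool-ext (mk⇔ (⊥-elim ∘ orientation-no-edge o x y)
                                     (⊥-elim ∘ orientation-no-edge o y x))
    ; E-irr = λ x → orientation-no-edge o x x
    ; A-irr = λ x → [ A-irr x , E-irr x ]′ ∘ newArc x x
    ; E-dom = λ x y → ⊥-elim ∘ orientation-no-edge o x y
    ; A-dom = λ x y → Product.map inVH inVH ∘ orientation-arc-support wf o
    ; E-A   = λ x y → ⊥-elim ∘ orientation-no-edge o x y }
    where
    open WF wf
    open IsOrientation o
    inVH : ∀ {x} → x ∈ V G → x ∈ V H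
    inVH {x} = subst (λ X → x ∈ X) (sym sameV)

  restrict-isAcyclicOrientation : ∀ P → IsAcyclicOrientation G H →
                                  IsAcyclicOrientation (restrict G P) (restrict H P)
  restrict-isAcyclicOrientation P (o , acyclic) =
    record
      { sameV   = refl
      ; noEdges = emptyMat-unique (λ x y → orientation-no-edge o x y ∘ proj₁ ∘ to (Edge-restrict H P))
      ; keepArc = λ x y a → let (a , px , py) = to (Arc-restrict G P) a in
                    from (Arc-restrict H P) (keepArc x y a , px , py)
      ; newArc  = λ x y a → let (a , px , py) = to (Arc-restrict H P) a in
                    Sum.map (λ a → from (Arc-restrict G P) (a , px , py))
                            (λ e → from (Edge-restrict G P) (e , px , py)) (newArc x y a)
      ; orient  = λ x y e → let (e , px , py) = to (Edge-restrict G P) e in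
                    ExactlyOneArc-cong {H = H} {restrict H P} (arcsIn px py) (arcsIn py px) (orient x y e) }
    , acyclic-antimono (proj₁ ∘ to (Arc-restrict H P)) acyclic
    where
    open IsOrientation o
    arcsIn : ∀ {x y} → x ∈ P → y ∈ P → Arc H x y ⇔ Arc (restrict H P) x y
    arcsIn px py = mk⇔ (λ a → from (Arc-restrict H P) (a , px , py)) (proj₁ ∘ to (Arc-restrict H P))

module _ {N : ℕ} {K : MG N} {J : VSet N} (ideal : IsIdeal J K) where

  ideal-walk-end : ∀ {x z n} → x ∈ J → Walk K x z n → z ∈ J
  ideal-walk-end xJ stop       = xJ
  ideal-walk-end xJ (step a w) = ideal-walk-end (ideal _ _ xJ a) w

  ideal-walk : ∀ {x z n} → x ∈ J → Walk K x z n → Walk (restrict K J) x z n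
  ideal-walk xJ stop       = stop
  ideal-walk xJ (step a w) = let yJ = ideal _ _ xJ a in step (from (Arc-restrict K J) (a , xJ , yJ)) (ideal-walk yJ w)

  -- A cycle through J stays in J, and a cycle avoiding J stays in I.
  acyclic-from-ideal : ∀ {I} → (∀ {x y} → Arc K x y → (x ∈ I ⊎ x ∈ J) × (y ∈ I ⊎ y ∈ J)) →
                       Disjoint I J → Acyclic (restrict K I) → Acyclic (restrict K J) → Acyclic K
  acyclic-from-ideal {I} covered disjoint acyclicI acyclicJ x n 2≤n w@(step a _) with proj₁ (covered a)
  ... | inj₁ xI = acyclicI x n 2≤n (coideal-walk xI xI w)
    where
    coideal-walk : ∀ {x z n} → x ∈ I → z ∈ I → Walk K x z n → Walk (restrict K I) x z n
    coideal-walk xI zI stop = stop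
    coideal-walk xI zI (step a w) with proj₂ (covered a)
    ... | inj₁ yI = step (from (Arc-restrict K I) (a , xI , yI)) (coideal-walk yI zI w)
    ... | inj₂ yJ = ⊥-elim (disjoint _ zI (ideal-walk-end yJ w))
  ... | inj₂ xJ = acyclicJ x n 2≤n (ideal-walk xJ w)

·-comm : ∀ {N} (G H : MG N) → G · H ≡ H · G
·-comm G H = MG-≡ (tabulate-cong (λ x → Bool.∨-comm (lookup (V G) x) _))
                  (mat-cong (λ x y → Bool.∨-comm (at (E G) x y) _))
                  (mat-cong (λ x y → Bool.∨-comm (at (A G) x y) _))

module _ {N : ℕ} {G H : MG N} (wfG : WF G) (wfH : WF H) (disjoint : Disjoint (V G) (V H)) where
  private
    module WG = WF wfG
    module WH = WF wfH

  ·-support : ∀ {x y} → Arc (G · H) x y ⊎ Edge (G · H) x y →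
              (x ∈ V G × y ∈ V G) ⊎ (x ∈ V H × y ∈ V H)
  ·-support {x} {y} (inj₁ a) = Sum.map (WG.A-dom x y) (WH.A-dom x y) (to (Arc-· G H) a)
  ·-support {x} {y} (inj₂ e) = Sum.map (WG.E-dom x y) (WH.E-dom x y) (to (Edge-· G H) e)

  Arc-·ˡ : ∀ {x y} → x ∈ V G → Arc G x y ⇔ Arc (G · H) x y
  Arc-·ˡ {x} {y} xG = mk⇔ (from (Arc-· G H) ∘ inj₁) ([ id , notH ]′ ∘ to (Arc-· G H))
    where
    notH : Arc H x y → Arc G x y
    notH a = ⊥-elim (disjoint x xG (proj₁ (WH.A-dom x y a)))

  Arc-·ʳ : ∀ {x y} → x ∈ V H → Arc H x y ⇔ Arc (G · H) x y
  Arc-·ʳ {x} {y} xH = mk⇔ (from (Arc-· G H) ∘ inj₂) ([ notG , id ]′ ∘ to (Arc-· G H))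
    where
    notG : Arc G x y → Arc H x y
    notG a = ⊥-elim (disjoint x (proj₁ (WG.A-dom x y a)) xH)

  restrict-·ˡ : restrict (G · H) (V G) ≡ G
  restrict-·ˡ = MG-≡ refl (mat-ext λ x y → mk⇔ (edgeG ∘ to (Edge-restrict (G · H) (V G))) (edge·  x y))
                          (mat-ext λ x y → mk⇔ (arcG ∘ to (Arc-restrict (G · H) (V G))) (arc· x y))
    where
    edgeG : ∀ {x y} → Edge (G · H) x y × x ∈ V G × y ∈ V G → Edge G x y
    edgeG {x} {y} (e , xG , _) =
      [ id , (λ e → ⊥-elim (disjoint x xG (proj₁ (WH.E-dom x y e)))) ]′ (to (Edge-· G H) e)
    edge· : ∀ x y → Edge G x y → Edge (restrict (G · H) (V G)) x y
    edge· x y e = from (Edge-restrict (G · H) (V G)) (from (Edge-· G H) (inj₁ e) , WG.E-dom x y e)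
    arcG : ∀ {x y} → Arc (G · H) x y × x ∈ V G × y ∈ V G → Arc G x y
    arcG (a , xG , _) = from (Arc-·ˡ xG) a
    arc· : ∀ x y → Arc G x y → Arc (restrict (G · H) (V G)) x y
    arc· x y a = let (xG , yG) = WG.A-dom x y a in from (Arc-restrict (G · H) (V G)) (to (Arc-·ˡ xG) a , xG , yG)

restrict-·ʳ : ∀ {N} {G H : MG N} → WF G → WF H → Disjoint (V G) (V H) → restrict (G · H) (V H) ≡ H
restrict-·ʳ {G = G} {H} wfG wfH disjoint =
  trans (cong (λ K → restrict K (V H)) (·-comm G H)) (restrict-·ˡ wfH wfG (λ x xH xG → disjoint x xG xH))

module _ {N : ℕ} {G H : MG N} (wfG : WF G) (wfH : WF H) (disjoint : Disjoint (V G) (V H)) where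

  acyclic-· : Acyclic G → Acyclic H → Acyclic (G · H)
  acyclic-· acyclicG acyclicH =
    acyclic-from-ideal ideal covered disjoint
      (subst Acyclic (sym (restrict-·ˡ wfG wfH disjoint)) acyclicG)
      (subst Acyclic (sym (restrict-·ʳ wfG wfH disjoint)) acyclicH)
    where
    covered : ∀ {x y} → Arc (G · H) x y → (x ∈ V G ⊎ x ∈ V H) × (y ∈ V G ⊎ y ∈ V H)
    covered a = [ (λ (xG , yG) → inj₁ xG , inj₁ yG) , (λ (xH , yH) → inj₂ xH , inj₂ yH) ]′
                  (·-support wfG wfH disjoint (inj₁ a))
    ideal : IsIdeal (V H) (G · H)
    ideal y z yH a =
      [ (λ (yG , _) → ⊥-elim (disjoint y yG yH)) , proj₂ ]′ (·-support wfG wfH disjoint (inj₁ a))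

  ·-restrict-orientation : ∀ {K} → IsOrientation (G · H) K → restrict K (V G) · restrict K (V H) ≡ K
  ·-restrict-orientation {K} o =
    oriented-ext (sym sameV)
      (emptyMat-unique λ x y → [ orientation-no-edge o x y ∘ proj₁ ∘ to (Edge-restrict K (V G))
                               , orientation-no-edge o x y ∘ proj₁ ∘ to (Edge-restrict K (V H)) ]′
                               ∘ to (Edge-· (restrict K (V G)) (restrict K (V H))))
      noEdges
      (λ x y → mk⇔ ([ proj₁ ∘ to (Arc-restrict K (V G)) , proj₁ ∘ to (Arc-restrict K (V H)) ]′
                     ∘ to (Arc-· (restrict K (V G)) (restrict K (V H))))
                   (λ a → from (Arc-· (restrict K (V G)) (restrict K (V H)))
                            (Sum.map (λ (xG , yG) → from (Arc-restrict K (V G)) (a , xG , yG))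
                                          (λ (xH , yH) → from (Arc-restrict K (V H)) (a , xH , yH))
                                          (·-support wfG wfH disjoint (newArc x y a)))))
    where open IsOrientation o

orientation-disjoint : ∀ {N} {G H K L : MG N} → IsOrientation G K → IsOrientation H L →
                       Disjoint (V G) (V H) → Disjoint (V K) (V L)
orientation-disjoint oK oL disjoint x xK xL =
  disjoint x (subst (x ∈_) (IsOrientation.sameV oK) xK) (subst (x ∈_) (IsOrientation.sameV oL) xL)

·-isAcyclicOrientation : ∀ {N} {G H K L : MG N} → WF G → WF H → Disjoint (V G) (V H) →
                         IsAcyclicOrientation G K → IsAcyclicOrientation H L →
                         IsAcyclicOrientation (G · H) (K · L)
·-isAcyclicOrientation {G = G} {H} {K} {L} wfG wfH disjoint (oK , acyclicK) (oL , acyclicL) =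
  record
    { sameV   = cong₂ (λ X Y → tabulate (λ x → lookup X x ∨ lookup Y x)) OK.sameV OL.sameV
    ; noEdges = emptyMat-unique λ x y →
                  [ orientation-no-edge oK x y , orientation-no-edge oL x y ]′ ∘ to (Edge-· K L)
    ; keepArc = λ x y → from (Arc-· K L) ∘ Sum.map (OK.keepArc x y) (OL.keepArc x y) ∘ to (Arc-· G H)
    ; newArc  = λ x y → [ Sum.map (from (Arc-· G H) ∘ inj₁) (from (Edge-· G H) ∘ inj₁) ∘ OK.newArc x y
                        , Sum.map (from (Arc-· G H) ∘ inj₂) (from (Edge-· G H) ∘ inj₂) ∘ OL.newArc x y ]′
                      ∘ to (Arc-· K L)
    ; orient  = orient }
  , acyclic-· wfK wfL disjointKL acyclicK acyclicL
  where
  module OK = IsOrientation oK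
  module OL = IsOrientation oL
  wfK : WF K
  wfK = orientation-WF wfG oK
  wfL : WF L
  wfL = orientation-WF wfH oL
  disjointKL : Disjoint (V K) (V L)
  disjointKL = orientation-disjoint oK oL disjoint
  inK : ∀ {v} → v ∈ V G → v ∈ V K
  inK {v} = subst (v ∈_) (sym OK.sameV)
  inL : ∀ {v} → v ∈ V H → v ∈ V L
  inL {v} = subst (v ∈_) (sym OL.sameV)
  orient : ∀ x y → Edge (G · H) x y → ExactlyOneArc (K · L) x y
  orient x y e with to (Edge-· G H) e
  ... | inj₁ eG = let (xG , yG) = WF.E-dom wfG x y eG in
    ExactlyOneArc-cong {H = K} {K · L} (Arc-·ˡ wfK wfL disjointKL (inK xG)) (Arc-·ˡ wfK wfL disjointKL (inK yG))
                       (OK.orient x y eG)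
  ... | inj₂ eH = let (xH , yH) = WF.E-dom wfH x y eH in
    ExactlyOneArc-cong {H = L} {K · L} (Arc-·ʳ wfK wfL disjointKL (inL xH)) (Arc-·ʳ wfK wfL disjointKL (inL yH))
                       (OL.orient x y eH)


Θ-· : ∀ {N} {G H : MG N} → WF G → WF H → Disjoint (V G) (V H) → Θ (G · H) ≋ (Θ G ⋆ Θ H)
Θ-· {G = G} {H} wfG wfH disjoint = record
  { bij  = mk↔ₛ′
      (λ { (K , [ o ]) → (restrict K (V G) , [ restrictˡ o ]) , (restrict K (V H) , [ restrictʳ o ]) })
      (λ { ((K , [ oK ]) , (L , [ oL ])) → K · L , [ ·-isAcyclicOrientation wfG wfH disjoint oK oL ] })
      (λ { ((K , [ oK ]) , (L , [ oL ])) →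
           cong₂ _,_ (Σ-irrelevant-≡ (MG-recompute (restrict-orientationˡ (proj₁ oK) (proj₁ oL))))
                     (Σ-irrelevant-≡ (MG-recompute (restrict-orientationʳ (proj₁ oK) (proj₁ oL)))) })
      (λ { (K , [ o ]) → Σ-irrelevant-≡ (glue o) })
  ; resp = λ { (K , [ o ]) → glue o } }
  where
  restrictˡ : ∀ {K} → IsAcyclicOrientation (G · H) K → IsAcyclicOrientation G (restrict K (V G))
  restrictˡ {K} o = subst (λ G' → IsAcyclicOrientation G' (restrict K (V G))) (restrict-·ˡ wfG wfH disjoint)
                      (restrict-isAcyclicOrientation (V G) o)
  restrictʳ : ∀ {K} → IsAcyclicOrientation (G · H) K → IsAcyclicOrientation H (restrict K (V H))
  restrictʳ {K} o = subst (λ H' → IsAcyclicOrientation H' (restrict K (V H))) (restrict-·ʳ wfG wfH disjoint)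
                      (restrict-isAcyclicOrientation (V H) o)
  glue : ∀ {K} → .(IsAcyclicOrientation (G · H) K) → restrict K (V G) · restrict K (V H) ≡ K
  glue o = MG-recompute (·-restrict-orientation wfG wfH disjoint (proj₁ o))
  restrict-orientationˡ : ∀ {K L} → IsOrientation G K → IsOrientation H L → restrict (K · L) (V G) ≡ K
  restrict-orientationˡ {K} {L} oK oL =
    subst (λ X → restrict (K · L) X ≡ K) (IsOrientation.sameV oK)
          (restrict-·ˡ (orientation-WF wfG oK) (orientation-WF wfH oL) (orientation-disjoint oK oL disjoint))
  restrict-orientationʳ : ∀ {K L} → IsOrientation G K → IsOrientation H L → restrict (K · L) (V H) ≡ L
  restrict-orientationʳ {K} {L} oK oL =
    subst (λ X → restrict (K · L) X ≡ L) (IsOrientation.sameV oL)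
          (restrict-·ʳ (orientation-WF wfG oK) (orientation-WF wfH oL) (orientation-disjoint oK oL disjoint))

restrict-orientation-arc : ∀ {N} (G : MG N) {H P x y} → IsOrientation (restrict G P) H → Arc H x y →
                           (Arc G x y ⊎ Edge G x y) × x ∈ P × y ∈ P
restrict-orientation-arc G {P = P} {x} {y} o a with IsOrientation.newArc o x y a
... | inj₁ a' = let (a' , xP , yP) = to (Arc-restrict G P) a' in inj₁ a' , xP , yP
... | inj₂ e  = let (e , xP , yP) = to (Edge-restrict G P) e in inj₂ e , xP , yP

oriented-restrict : ∀ {N} (K : MG N) P → Oriented K → Oriented (restrict K P)
oriented-restrict K P oK = emptyMat-unique λ x y →
  emptyMat-false x y ∘ subst (λ M → at M x y ≡ true) oK ∘ proj₁ ∘ to (Edge-restrict K P)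

idealGlue : ∀ {N} → MG N → VSet N → VSet N → MG N → MG N → MG N
idealGlue G I J H₁ H₂ = mg (V G) emptyMat (mat λ x y →
  at (A H₁) x y ∨ at (A H₂) x y ∨ ((at (A G) x y ∨ at (E G) x y) ∧ lookup I x ∧ lookup J y))

Arc-idealGlue : ∀ {N} (G : MG N) I J H₁ H₂ {x y} → Arc (idealGlue G I J H₁ H₂) x y ⇔
                (Arc H₁ x y ⊎ Arc H₂ x y ⊎ ((Arc G x y ⊎ Edge G x y) × x ∈ I × y ∈ J))
Arc-idealGlue G I J H₁ H₂ =
  ((⇔-id _ ⊎-⇔ ((⇔-id _ ⊎-⇔ ((∨-true ×-⇔ ∧-true) ⇔-∘ ∧-true)) ⇔-∘ ∨-true)) ⇔-∘ ∨-true)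
  ⇔-∘ mat-true (λ x y → at (A H₁) x y ∨ at (A H₂) x y ∨
                         ((at (A G) x y ∨ at (E G) x y) ∧ lookup I x ∧ lookup J y))

module _ {N : ℕ} {G : MG N} {I J : VSet N} (wf : WF G) (partition : DisjointUnion I J (V G)) where
  open WF wf
  private
    disjoint : Disjoint I J
    disjoint x xI xJ = proj₂ (proj₂ (proj₂ (partition x))) (xI , xJ)
    side : ∀ {x} → x ∈ V G → x ∈ I ⊎ x ∈ J
    side {x} = proj₁ (partition x)

  module _ {H₁ H₂ : MG N} (o₁ : IsOrientation (restrict G I) H₁)
                          (o₂ : IsOrientation (restrict G J) H₂) where
    private
      glued : MG N
      glued = idealGlue G I J H₁ H₂
      Arc-glued : ∀ {x y} → Arc glued x y ⇔
                  (Arc H₁ x y ⊎ Arc H₂ x y ⊎ ((Arc G x y ⊎ Edge G x y) × x ∈ I × y ∈ J))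
      Arc-glued = Arc-idealGlue G I J H₁ H₂

    IdealGlueArc : Fin N → Fin N → Set
    IdealGlueArc x y = (Arc H₁ x y × x ∈ I × y ∈ I) ⊎ (Arc H₂ x y × x ∈ J × y ∈ J) ⊎
                   ((Arc G x y ⊎ Edge G x y) × x ∈ I × y ∈ J)

    idealGlue-arc : ∀ {x y} → Arc glued x y → IdealGlueArc x y
    idealGlue-arc a with to Arc-glued a
    ... | inj₁ a₁        = inj₁ (a₁ , proj₂ (restrict-orientation-arc G o₁ a₁))
    ... | inj₂ (inj₁ a₂) = inj₂ (inj₁ (a₂ , proj₂ (restrict-orientation-arc G o₂ a₂)))
    ... | inj₂ (inj₂ c)  = inj₂ (inj₂ c)

    idealGlue-within-I : ∀ {x y} → x ∈ I → y ∈ I → Arc H₁ x y ⇔ Arc glued x y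
    idealGlue-within-I {x} {y} xI yI = mk⇔ (from Arc-glued ∘ inj₁) (back ∘ idealGlue-arc)
      where
      back : IdealGlueArc x y → Arc H₁ x y
      back (inj₁ (a , _))               = a
      back (inj₂ (inj₁ (_ , xJ , _)))   = ⊥-elim (disjoint x xI xJ)
      back (inj₂ (inj₂ (_ , _ , yJ)))   = ⊥-elim (disjoint y yI yJ)

    idealGlue-within-J : ∀ {x y} → x ∈ J → y ∈ J → Arc H₂ x y ⇔ Arc glued x y
    idealGlue-within-J {x} {y} xJ yJ = mk⇔ (from Arc-glued ∘ inj₂ ∘ inj₁) (back ∘ idealGlue-arc)
      where
      back : IdealGlueArc x y → Arc H₂ x y
      back (inj₁ (_ , xI , _))          = ⊥-elim (disjoint x xI xJ)
      back (inj₂ (inj₁ (a , _)))        = a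
      back (inj₂ (inj₂ (_ , xI , _)))   = ⊥-elim (disjoint x xI xJ)

    idealGlue-no-arc-JI : ∀ {x y} → x ∈ J → y ∈ I → ¬ Arc glued x y
    idealGlue-no-arc-JI {x} {y} xJ yI a with idealGlue-arc a
    ... | inj₁ (_ , xI , _)        = disjoint x xI xJ
    ... | inj₂ (inj₁ (_ , _ , yJ)) = disjoint y yI yJ
    ... | inj₂ (inj₂ (_ , xI , _)) = disjoint x xI xJ

    idealGlue-isIdeal : IsIdeal J glued
    idealGlue-isIdeal y z yJ a with idealGlue-arc a
    ... | inj₁ (_ , yI , _)        = ⊥-elim (disjoint y yI yJ)
    ... | inj₂ (inj₁ (_ , _ , zJ)) = zJ
    ... | inj₂ (inj₂ (_ , yI , _)) = ⊥-elim (disjoint y yI yJ)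

    restrict-idealGlue-I : restrict glued I ≡ H₁
    restrict-idealGlue-I =
      oriented-ext (sym (IsOrientation.sameV o₁)) (oriented-restrict glued I refl) (IsOrientation.noEdges o₁)
        λ x y → mk⇔ (λ a → let (a , xI , yI) = to (Arc-restrict glued I) a in from (idealGlue-within-I xI yI) a)
                    (λ a → let (_ , xI , yI) = restrict-orientation-arc G o₁ a in
                           from (Arc-restrict glued I) (to (idealGlue-within-I xI yI) a , xI , yI))

    restrict-idealGlue-J : restrict glued J ≡ H₂
    restrict-idealGlue-J =
      oriented-ext (sym (IsOrientation.sameV o₂)) (oriented-restrict glued J refl) (IsOrientation.noEdges o₂)
        λ x y → mk⇔ (λ a → let (a , xJ , yJ) = to (Arc-restrict glued J) a in from (idealGlue-within-J xJ yJ) a)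
                    (λ a → let (_ , xJ , yJ) = restrict-orientation-arc G o₂ a in
                           from (Arc-restrict glued J) (to (idealGlue-within-J xJ yJ) a , xJ , yJ))

    idealGlue-isOrientation : IsIdeal J G → IsOrientation G glued
    idealGlue-isOrientation ideal = record
      { sameV   = refl
      ; noEdges = refl
      ; keepArc = keep
      ; newArc  = λ x y → [ proj₁ ∘ restrict-orientation-arc G o₁
                          , [ proj₁ ∘ restrict-orientation-arc G o₂ , proj₁ ]′ ]′ ∘ to Arc-glued
      ; orient  = orient }
      where
      module O₁ = IsOrientation o₁
      module O₂ = IsOrientation o₂
      keep : ∀ x y → Arc G x y → Arc glued x y
      keep x y a with side (proj₁ (A-dom x y a)) | side (proj₂ (A-dom x y a))
      ... | inj₁ xI | inj₁ yI =
        to (idealGlue-within-I xI yI) (O₁.keepArc x y (from (Arc-restrict G I) (a , xI , yI)))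
      ... | inj₂ xJ | inj₂ yJ =
        to (idealGlue-within-J xJ yJ) (O₂.keepArc x y (from (Arc-restrict G J) (a , xJ , yJ)))
      ... | inj₁ xI | inj₂ yJ = from Arc-glued (inj₂ (inj₂ (inj₁ a , xI , yJ)))
      ... | inj₂ xJ | inj₁ yI = ⊥-elim (disjoint y yI (ideal x y xJ a))
      orient : ∀ x y → Edge G x y → ExactlyOneArc glued x y
      orient x y e with side (proj₁ (E-dom x y e)) | side (proj₂ (E-dom x y e))
      ... | inj₁ xI | inj₁ yI =
        ExactlyOneArc-cong {H = H₁} {glued} (idealGlue-within-I xI yI) (idealGlue-within-I yI xI)
                           (O₁.orient x y (from (Edge-restrict G I) (e , xI , yI)))
      ... | inj₂ xJ | inj₂ yJ =
        ExactlyOneArc-cong {H = H₂} {glued} (idealGlue-within-J xJ yJ) (idealGlue-within-J yJ xJ)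
                           (O₂.orient x y (from (Edge-restrict G J) (e , xJ , yJ)))
      ... | inj₁ xI | inj₂ yJ =
        inj₁ (from Arc-glued (inj₂ (inj₂ (inj₂ e , xI , yJ))) , idealGlue-no-arc-JI yJ xI)
      ... | inj₂ xJ | inj₁ yI = inj₂ (idealGlue-no-arc-JI xJ yI ,
                                      from Arc-glued (inj₂ (inj₂ (inj₂ (trans (E-sym y x) e) , yI , xJ))))

    idealGlue-acyclic : Acyclic H₁ → Acyclic H₂ → Acyclic glued
    idealGlue-acyclic acyclic₁ acyclic₂ =
      acyclic-from-ideal idealGlue-isIdeal covered disjoint
        (subst Acyclic (sym restrict-idealGlue-I) acyclic₁) (subst Acyclic (sym restrict-idealGlue-J) acyclic₂)
      where
      covered : ∀ {x y} → Arc glued x y → (x ∈ I ⊎ x ∈ J) × (y ∈ I ⊎ y ∈ J)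
      covered a with idealGlue-arc a
      ... | inj₁ (_ , xI , yI)        = inj₁ xI , inj₁ yI
      ... | inj₂ (inj₁ (_ , xJ , yJ)) = inj₂ xJ , inj₂ yJ
      ... | inj₂ (inj₂ (_ , xI , yJ)) = inj₁ xI , inj₂ yJ

  idealGlue-isAcyclicOrientation : ∀ {H₁ H₂} → IsIdeal J G → IsAcyclicOrientation (restrict G I) H₁ →
                                   IsAcyclicOrientation (restrict G J) H₂ →
                                   IsAcyclicOrientation G (idealGlue G I J H₁ H₂)
  idealGlue-isAcyclicOrientation ideal (o₁ , acyclic₁) (o₂ , acyclic₂) =
    idealGlue-isOrientation o₁ o₂ ideal , idealGlue-acyclic o₁ o₂ acyclic₁ acyclic₂

  idealGlue-restrict : ∀ {H} → IsOrientation G H → IsIdeal J H →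
                       idealGlue G I J (restrict H I) (restrict H J) ≡ H
  idealGlue-restrict {H} o ideal = oriented-ext (sym sameV) refl noEdges λ x y → mk⇔ (forth x y) (back x y)
    where
    open IsOrientation o
    Arc-glued : ∀ {x y} → Arc (idealGlue G I J (restrict H I) (restrict H J)) x y ⇔
                (Arc (restrict H I) x y ⊎ Arc (restrict H J) x y ⊎
                 ((Arc G x y ⊎ Edge G x y) × x ∈ I × y ∈ J))
    Arc-glued = Arc-idealGlue G I J (restrict H I) (restrict H J)
    forth : ∀ x y → Arc (idealGlue G I J (restrict H I) (restrict H J)) x y → Arc H x y
    forth x y a with to Arc-glued a
    ... | inj₁ a₁                        = proj₁ (to (Arc-restrict H I) a₁)
    ... | inj₂ (inj₁ a₂)                 = proj₁ (to (Arc-restrict H J) a₂)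
    ... | inj₂ (inj₂ (inj₁ a , _))       = keepArc x y a
    ... | inj₂ (inj₂ (inj₂ e , xI , yJ)) =
      [ proj₁ , (λ (_ , a) → ⊥-elim (disjoint x xI (ideal y x yJ a))) ]′ (orient x y e)
    back : ∀ x y → Arc H x y → Arc (idealGlue G I J (restrict H I) (restrict H J)) x y
    back x y a with side (proj₁ (orientation-arc-support wf o a)) | side (proj₂ (orientation-arc-support wf o a))
    ... | inj₁ xI | inj₁ yI = from Arc-glued (inj₁ (from (Arc-restrict H I) (a , xI , yI)))
    ... | inj₂ xJ | inj₂ yJ = from Arc-glued (inj₂ (inj₁ (from (Arc-restrict H J) (a , xJ , yJ))))
    ... | inj₁ xI | inj₂ yJ = from Arc-glued (inj₂ (inj₂ (newArc x y a , xI , yJ)))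
    ... | inj₂ xJ | inj₁ yI = ⊥-elim (disjoint y yI (ideal x y xJ a))

  Θ-Δ : Θ⊗Θ (Δ I J G) ≋ bind (Θ G) (Δ I J)
  Θ-Δ = record
    { bij  = mk↔ₛ′
        (λ { ([ ideal ] , ((H₁ , [ o₁ ]) , (H₂ , [ o₂ ]))) →
             (idealGlue G I J H₁ H₂ , [ idealGlue-isAcyclicOrientation ideal o₁ o₂ ]) ,
             [ idealGlue-isIdeal (proj₁ o₁) (proj₁ o₂) ] })
        (λ { ((H , [ o ]) , [ ideal ]) →
             [ (λ y z yJ → ideal y z yJ ∘ IsOrientation.keepArc (proj₁ o) y z) ] ,
             ((restrict H I , [ restrict-isAcyclicOrientation I o ]) ,
              (restrict H J , [ restrict-isAcyclicOrientation J o ])) })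
        (λ { ((H , [ o ]) , [ ideal ]) →
             Σ-irrelevant-≡ (Σ-irrelevant-≡ (MG-recompute (idealGlue-restrict (proj₁ o) ideal))) })
        (λ { ([ ideal ] , ((H₁ , [ o₁ ]) , (H₂ , [ o₂ ]))) →
             cong ([ ideal ] ,_)
                  (cong₂ _,_ (Σ-irrelevant-≡ (restrictI o₁ o₂)) (Σ-irrelevant-≡ (restrictJ o₁ o₂))) })
    ; resp = λ { ([ ideal ] , ((H₁ , [ o₁ ]) , (H₂ , [ o₂ ]))) →
                 cong₂ _,_ (restrictI o₁ o₂) (restrictJ o₁ o₂) } }
    where
    restrictI : ∀ {H₁ H₂} → .(IsAcyclicOrientation (restrict G I) H₁) →
                .(IsAcyclicOrientation (restrict G J) H₂) → restrict (idealGlue G I J H₁ H₂) I ≡ H₁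
    restrictI o₁ o₂ = MG-recompute (restrict-idealGlue-I (proj₁ o₁) (proj₁ o₂))
    restrictJ : ∀ {H₁ H₂} → .(IsAcyclicOrientation (restrict G I) H₁) →
                .(IsAcyclicOrientation (restrict G J) H₂) → restrict (idealGlue G I J H₁ H₂) J ≡ H₂
    restrictJ o₁ o₂ = MG-recompute (restrict-idealGlue-J (proj₁ o₁) (proj₁ o₂))

Linked-map : ∀ {N} {G H : MG N} {P P' : Fin N → Set} → (∀ {z} → P z → P' z) →
             (∀ {x y} → Adj G x y → Adj H x y) → ∀ {x y} → Linked G P x y → Linked H P' x y
Linked-map f g here        = here
Linked-map f g (hop p a l) = hop (f p) (g a) (Linked-map f g l)

module _ {N : ℕ} {G H : MG N} (wf : WF G) (o : IsOrientation G H) where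
  open IsOrientation o

  orientation-Adj : ∀ {x y} → Adj G x y ⇔ Adj H x y
  orientation-Adj {x} {y} = mk⇔ forth back
    where
    forth : Adj G x y → Adj H x y
    forth (inj₁ e)        = [ inj₂ ∘ inj₁ ∘ proj₁ , inj₂ ∘ inj₂ ∘ proj₂ ]′ (orient x y e)
    forth (inj₂ (inj₁ a)) = inj₂ (inj₁ (keepArc x y a))
    forth (inj₂ (inj₂ a)) = inj₂ (inj₂ (keepArc y x a))
    back : Adj H x y → Adj G x y
    back (inj₁ e)        = ⊥-elim (orientation-no-edge o x y e)
    back (inj₂ (inj₁ a)) = [ inj₂ ∘ inj₁ , inj₁ ]′ (newArc x y a)
    back (inj₂ (inj₂ a)) = [ inj₂ ∘ inj₂ , inj₁ ∘ trans (WF.E-sym wf x y) ]′ (newArc y x a)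

  orientation-ConnClasses : ∀ r → ConnClasses G r ⇔ ConnClasses H r
  orientation-ConnClasses r = mk⇔
    (λ conn x y xH yH rx≡ry → Linked-map (Product.map₁ inG⇒inH) (to orientation-Adj)
                                         (conn x y (inH⇒inG xH) (inH⇒inG yH) rx≡ry))
    (λ conn x y xG yG rx≡ry → Linked-map (Product.map₁ inH⇒inG) (from orientation-Adj)
                                         (conn x y (inG⇒inH xG) (inG⇒inH yG) rx≡ry))
    where
    inH⇒inG : ∀ {x} → x ∈ V H → x ∈ V G
    inH⇒inG {x} = subst (x ∈_) sameV
    inG⇒inH : ∀ {x} → x ∈ V G → x ∈ V H
    inG⇒inH {x} = subst (x ∈_) (sym sameV)

module _ {N : ℕ} {G H : MG N} (r : Fin N → Fin N) where

  inner-isAcyclicOrientation : IsAcyclicOrientation G H → IsAcyclicOrientation (inner G r) (inner H r)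
  inner-isAcyclicOrientation (o , acyclic) =
    record
      { sameV   = sameV
      ; noEdges = emptyMat-unique (λ x y → orientation-no-edge o x y ∘ proj₁ ∘ to (Edge-inner H r))
      ; keepArc = λ x y a → let (a , same) = to (Arc-inner G r) a in from (Arc-inner H r) (keepArc x y a , same)
      ; newArc  = λ x y a → let (a , same) = to (Arc-inner H r) a in
                    Sum.map (λ a → from (Arc-inner G r) (a , same)) (λ e → from (Edge-inner G r) (e , same))
                                 (newArc x y a)
      ; orient  = λ x y e → let (e , same) = to (Edge-inner G r) e in
                    ExactlyOneArc-cong {H = H} {inner H r} (arcsIn same) (arcsIn (sym same)) (orient x y e) }
    , acyclic-antimono (proj₁ ∘ to (Arc-inner H r)) acyclic
    where
    open IsOrientation o
    arcsIn : ∀ {x y} → r x ≡ r y → Arc H x y ⇔ Arc (inner H r) x y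
    arcsIn same = mk⇔ (λ a → from (Arc-inner H r) (a , same)) (proj₁ ∘ to (Arc-inner H r))

inner-orientation-arc : ∀ {N} (G : MG N) r {C x y} → IsOrientation (inner G r) C → Arc C x y →
                        (Arc G x y ⊎ Edge G x y) × r x ≡ r y
inner-orientation-arc G r {x = x} {y} o a with IsOrientation.newArc o x y a
... | inj₁ a' = let (a' , same) = to (Arc-inner G r) a' in inj₁ a' , same
... | inj₂ e  = let (e , same) = to (Edge-inner G r) e in inj₂ e , same

quot-orientation-loopless : ∀ {N} (G : MG N) r {Q a} → IsOrientation (quot G r) Q → ¬ Arc Q a a
quot-orientation-loopless G r {a = a} o q =
  [ (λ l → proj₁ (to (Arc-quot G r) l) refl) , (λ l → proj₁ (to (Edge-quot G r) l) refl) ]′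
    (IsOrientation.newArc o a a q)

quotGlue : ∀ {N} → MG N → (Fin N → Fin N) → MG N → MG N → MG N
quotGlue G r Q C = mg (V G) emptyMat (mat λ x y →
  ((r x == r y) ∧ at (A C) x y) ∨
  (not (r x == r y) ∧ (at (A G) x y ∨ (at (E G) x y ∧ at (A Q) (r x) (r y)))))

Arc-quotGlue : ∀ {N} (G : MG N) r Q C {x y} → Arc (quotGlue G r Q C) x y ⇔
               ((r x ≡ r y × Arc C x y) ⊎ (¬ r x ≡ r y × (Arc G x y ⊎ (Edge G x y × Arc Q (r x) (r y)))))
Arc-quotGlue G r Q C =
  ((((==-true ×-⇔ ⇔-id _) ⇔-∘ ∧-true) ⊎-⇔
    ((not==-true ×-⇔ ((⇔-id _ ⊎-⇔ ∧-true) ⇔-∘ ∨-true)) ⇔-∘ ∧-true)) ⇔-∘ ∨-true)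
  ⇔-∘ mat-true (λ x y → ((r x == r y) ∧ at (A C) x y) ∨
                         (not (r x == r y) ∧ (at (A G) x y ∨ (at (E G) x y ∧ at (A Q) (r x) (r y)))))

quot-arc : ∀ {N} (K : MG N) r {x y} → Arc K x y → ¬ r x ≡ r y → Arc (quot K r) (r x) (r y)
quot-arc K r {x} {y} a ne = from (Arc-quot K r) (ne , x , y , a , refl , refl)

quot-arc-mono : ∀ {N} (K L : MG N) r → (∀ {x y} → Arc K x y → Arc L x y) →
                ∀ {a b} → Arc (quot K r) a b → Arc (quot L r) a b
quot-arc-mono K L r K⊆L q =
  let (ne , x , y , a , rx , ry) = to (Arc-quot K r) q in from (Arc-quot L r) (ne , x , y , K⊆L a , rx , ry)

module _ {N : ℕ} {G H : MG N} (r : Fin N → Fin N) (o : IsOrientation G H) (acyclicQ : Acyclic (quot H r)) where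
  open IsOrientation o

  quot-isOrientation : IsOrientation (quot G r) (quot H r)
  quot-isOrientation = record
    { sameV   = cong (λ X → tabulate (λ a → lookup X a ∧ (r a == a))) sameV
    ; noEdges = emptyMat-unique λ a b e → let (_ , (x , y , e , _) , _) = to (Edge-quot H r) e in
                                          orientation-no-edge o x y e
    ; keepArc = λ a b → quot-arc-mono G H r (keepArc _ _)
    ; newArc  = new
    ; orient  = orientQ }
    where
    new : ∀ a b → Arc (quot H r) a b → Arc (quot G r) a b ⊎ Edge (quot G r) a b
    new a b q with to (Arc-quot H r) q
    ... | ne , x , y , arc , refl , refl with newArc x y arc | Arc? (quot G r) a b | Arc? (quot G r) b a
    ...   | inj₁ g | _ | _              = inj₁ (quot-arc G r g ne)
    ...   | inj₂ e | yes ab | _         = inj₁ ab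
    ...   | inj₂ e | no _   | yes ba    = ⊥-elim (acyclic-asym acyclicQ q (quot-arc-mono G H r (keepArc _ _) ba))
    ...   | inj₂ e | no ¬ab | no ¬ba    =
      inj₂ (from (Edge-quot G r) (ne , (x , y , e , refl , refl) , ¬ab , ¬ba))
    orientQ : ∀ a b → Edge (quot G r) a b → ExactlyOneArc (quot H r) a b
    orientQ a b eq with to (Edge-quot G r) eq
    ... | ne , (x , y , e , refl , refl) , _ with orient x y e
    ...   | inj₁ (xy , _) = let q = quot-arc H r xy ne in inj₁ (q , acyclic-asym acyclicQ q)
    ...   | inj₂ (_ , yx) = let q = quot-arc H r yx (ne ∘ sym) in
                              inj₂ ((λ q' → acyclic-asym acyclicQ q' q) , q)

  quotGlue-quot-inner : quotGlue G r (quot H r) (inner H r) ≡ H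
  quotGlue-quot-inner = oriented-ext (sym sameV) refl noEdges λ x y → mk⇔ (forth x y) (back x y)
    where
    forth : ∀ x y → Arc (quotGlue G r (quot H r) (inner H r)) x y → Arc H x y
    forth x y a with to (Arc-quotGlue G r (quot H r) (inner H r)) a
    ... | inj₁ (_ , c)              = proj₁ (to (Arc-inner H r) c)
    ... | inj₂ (_ , inj₁ g)         = keepArc x y g
    ... | inj₂ (ne , inj₂ (e , q))  =
      [ proj₁ , (λ (_ , yx) → ⊥-elim (acyclic-asym acyclicQ q (quot-arc H r yx (ne ∘ sym)))) ]′
        (orient x y e)
    back : ∀ x y → Arc H x y → Arc (quotGlue G r (quot H r) (inner H r)) x y
    back x y a with r x ≟ r y
    ... | yes same = from (Arc-quotGlue G r (quot H r) (inner H r)) (inj₁ (same , from (Arc-inner H r) (a , same)))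
    ... | no ne    = from (Arc-quotGlue G r (quot H r) (inner H r))
                          (inj₂ (ne , Sum.map₂ (λ e → e , quot-arc H r a ne) (newArc x y a)))

inner-orientation-walk : ∀ {N} (G : MG N) r {C x z n} → IsOrientation (inner G r) C → Walk C x z n → r x ≡ r z
inner-orientation-walk G r o stop       = refl
inner-orientation-walk G r o (step a w) =
  trans (proj₂ (inner-orientation-arc G r o a)) (inner-orientation-walk G r o w)

module _ {N : ℕ} {G : MG N} (wf : WF G) (r : Fin N → Fin N) {Q C : MG N}
         (oQ : IsAcyclicOrientation (quot G r) Q) (oC : IsAcyclicOrientation (inner G r) C) where
  private
    module OQ = IsOrientation (proj₁ oQ)
    module OC = IsOrientation (proj₁ oC)
    glued : MG N
    glued = quotGlue G r Q C
    Arc-glued : ∀ {x y} → Arc glued x y ⇔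
                ((r x ≡ r y × Arc C x y) ⊎ (¬ r x ≡ r y × (Arc G x y ⊎ (Edge G x y × Arc Q (r x) (r y)))))
    Arc-glued = Arc-quotGlue G r Q C

  quotGlue-across : ∀ {x y} → Arc glued x y → ¬ r x ≡ r y → Arc Q (r x) (r y)
  quotGlue-across a ne with to Arc-glued a
  ... | inj₁ (same , _)        = ⊥-elim (ne same)
  ... | inj₂ (_ , inj₁ g)      = OQ.keepArc _ _ (quot-arc G r g ne)
  ... | inj₂ (_ , inj₂ (_ , q)) = q

  quotGlue-within : ∀ {x y} → r x ≡ r y → Arc C x y ⇔ Arc glued x y
  quotGlue-within same = mk⇔ (λ c → from Arc-glued (inj₁ (same , c)))
                             ([ proj₂ , (λ (ne , _) → ⊥-elim (ne same)) ]′ ∘ to Arc-glued)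

  quotGlue-across-edge : ∀ {x y} → Edge G x y → ¬ r x ≡ r y → Arc Q (r x) (r y) ⇔ Arc glued x y
  quotGlue-across-edge e ne =
    mk⇔ (λ q → from Arc-glued (inj₂ (ne , inj₂ (e , q)))) (λ a → quotGlue-across a ne)

  quot-edge-oriented : ∀ {x y} → Edge G x y → ¬ r x ≡ r y → ExactlyOneArc Q (r x) (r y)
  quot-edge-oriented {x} {y} e ne with Arc? (quot G r) (r x) (r y) | Arc? (quot G r) (r y) (r x)
  ... | yes xy | _      = let q = OQ.keepArc _ _ xy in inj₁ (q , acyclic-asym (proj₂ oQ) q)
  ... | no _   | yes yx = let q = OQ.keepArc _ _ yx in inj₂ ((λ q' → acyclic-asym (proj₂ oQ) q' q) , q)
  ... | no ¬xy | no ¬yx = OQ.orient _ _ (from (Edge-quot G r) (ne , (x , y , e , refl , refl) , ¬xy , ¬yx))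

  quotGlue-isOrientation : IsOrientation G glued
  quotGlue-isOrientation = record
    { sameV   = refl
    ; noEdges = refl
    ; keepArc = keep
    ; newArc  = λ x y → [ proj₁ ∘ inner-orientation-arc G r (proj₁ oC) ∘ proj₂
                        , [ inj₁ , inj₂ ∘ proj₁ ]′ ∘ proj₂ ]′ ∘ to Arc-glued
    ; orient  = orient }
    where
    keep : ∀ x y → Arc G x y → Arc glued x y
    keep x y a with r x ≟ r y
    ... | yes same = to (quotGlue-within same) (OC.keepArc x y (from (Arc-inner G r) (a , same)))
    ... | no ne    = from Arc-glued (inj₂ (ne , inj₁ a))
    orient : ∀ x y → Edge G x y → ExactlyOneArc glued x y
    orient x y e with r x ≟ r y
    ... | yes same = ExactlyOneArc-cong {H = C} {glued} (quotGlue-within same) (quotGlue-within (sym same))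
                                        (OC.orient x y (from (Edge-inner G r) (e , same)))
    ... | no ne    = ExactlyOneArc-cong {H = Q} {glued}
                       (quotGlue-across-edge e ne) (quotGlue-across-edge (trans (WF.E-sym wf y x) e) (ne ∘ sym))
                       (quot-edge-oriented e ne)

  quotGlue-walk : ∀ {x z n} → Walk glued x z n → Walk C x z n ⊎ ∃ λ m → Walk Q (r x) (r z) (suc m)
  quotGlue-walk stop = inj₁ stop
  quotGlue-walk {x} {z} (step {y = y} a w) with r x ≟ r y | quotGlue-walk w
  ... | yes same | inj₁ c       = inj₁ (step (from (quotGlue-within same) a) c)
  ... | yes same | inj₂ (m , q) = inj₂ (m , subst (λ v → Walk Q v (r z) (suc m)) (sym same) q)
  ... | no ne    | inj₁ c       =
    let ry≡rz = inner-orientation-walk G r (proj₁ oC) c in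
    inj₂ (0 , step (quotGlue-across a ne) (subst (λ v → Walk Q (r y) v 0) ry≡rz stop))
  ... | no ne    | inj₂ (m , q) = inj₂ (suc m , step (quotGlue-across a ne) q)

  quotGlue-acyclic : Acyclic glued
  quotGlue-acyclic x n 2≤n w with quotGlue-walk w
  ... | inj₁ c                    = proj₂ oC x n 2≤n c
  ... | inj₂ (zero , step q stop) = quot-orientation-loopless G r (proj₁ oQ) q
  ... | inj₂ (suc m , q)          = proj₂ oQ (r x) (suc (suc m)) (s≤s (s≤s z≤n)) q

  quot-quotGlue : quot glued r ≡ Q
  quot-quotGlue =
    oriented-ext (sym OQ.sameV)
      (emptyMat-unique λ a b e → let (_ , (x , y , e , _) , _) = to (Edge-quot glued r) e in emptyMat-false x y e)
      OQ.noEdges λ a b → mk⇔ forth back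
    where
    forth : ∀ {a b} → Arc (quot glued r) a b → Arc Q a b
    forth q with to (Arc-quot glued r) q
    ... | ne , x , y , a , refl , refl = quotGlue-across a ne
    back : ∀ {a b} → Arc Q a b → Arc (quot glued r) a b
    back {a} {b} q with OQ.newArc a b q
    ... | inj₁ qG = quot-arc-mono G glued r (IsOrientation.keepArc quotGlue-isOrientation _ _) qG
    ... | inj₂ eq with to (Edge-quot G r) eq
    ...   | ne , (x , y , e , refl , refl) , _ = quot-arc glued r (from Arc-glued (inj₂ (ne , inj₂ (e , q)))) ne

  inner-quotGlue : inner glued r ≡ C
  inner-quotGlue =
    oriented-ext (sym OC.sameV) (emptyMat-unique λ x y → emptyMat-false x y ∘ proj₁ ∘ to (Edge-inner glued r))
      OC.noEdges λ x y →
      mk⇔ (λ a → let (a , same) = to (Arc-inner glued r) a in from (quotGlue-within same) a)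
          (λ c → let same = proj₂ (inner-orientation-arc G r (proj₁ oC) c) in
                 from (Arc-inner glued r) (to (quotGlue-within same) c , same))

Θ-δ : ∀ {N} {G : MG N} (r : Fin N → Fin N) → WF G → Θ⊗Θ (δ r G) ≋ bind (Θ G) (δac r)
Θ-δ {G = G} r wf = record
  { bij  = mk↔ₛ′
      (λ { ([ conn ] , ((Q , [ oQ ]) , (C , [ oC ]))) →
           (quotGlue G r Q C , [ quotGlue-isOrientation wf r oQ oC , quotGlue-acyclic wf r oQ oC ]) ,
           [ to (orientation-ConnClasses wf (quotGlue-isOrientation wf r oQ oC) r) conn ,
             subst Acyclic (sym (quot-quotGlue wf r oQ oC)) (proj₂ oQ) ] })
      (λ { ((H , [ o ]) , [ q ]) →
           [ from (orientation-ConnClasses wf (proj₁ o) r) (proj₁ q) ] ,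
           ((quot H r , [ quot-isOrientation r (proj₁ o) (proj₂ q) , proj₂ q ]) ,
            (inner H r , [ inner-isAcyclicOrientation r o ])) })
      (λ { ((H , [ o ]) , [ q ]) →
           Σ-irrelevant-≡ (Σ-irrelevant-≡ (MG-recompute (quotGlue-quot-inner r (proj₁ o) (proj₂ q)))) })
      (λ { ([ conn ] , ((Q , [ oQ ]) , (C , [ oC ]))) →
           cong ([ conn ] ,_) (cong₂ _,_ (Σ-irrelevant-≡ (quotQ oQ oC)) (Σ-irrelevant-≡ (innerC oQ oC))) })
  ; resp = λ { ([ conn ] , ((Q , [ oQ ]) , (C , [ oC ]))) → cong₂ _,_ (quotQ oQ oC) (innerC oQ oC) } }
  where
  quotQ : ∀ {Q C} → .(IsAcyclicOrientation (quot G r) Q) → .(IsAcyclicOrientation (inner G r) C) →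
          quot (quotGlue G r Q C) r ≡ Q
  quotQ oQ oC = MG-recompute (quot-quotGlue wf r oQ oC)
  innerC : ∀ {Q C} → .(IsAcyclicOrientation (quot G r) Q) → .(IsAcyclicOrientation (inner G r) C) →
           inner (quotGlue G r Q C) r ≡ C
  innerC oQ oC = MG-recompute (inner-quotGlue wf r oQ oC)

theorem4p2 : (N : ℕ) →
    -- multiplicativity: Θ(GH) = Θ(G)Θ(H) for disjoint vertex sets
    ((G H : MG N) → WF G → WF H → (∀ x → x ∈ V G → x ∈ V H → ⊥) →
       Θ (G · H) ≋ (Θ G ⋆ Θ H))
    -- unit: Θ(1) = 1
    × (Θ (emptyGraph {N}) ≋ single emptyGraph)
    -- compatibility with Δ_{I,J}
    × ((G : MG N) (I J : VSet N) → WF G → DisjointUnion I J (V G) →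
       Θ⊗Θ (Δ I J G) ≋ bind (Θ G) (Δ I J))
    -- compatibility with δ_∼ for every equivalence ∼ on V(G)
    × ((G : MG N) (r : Fin N → Fin N) → WF G → Represents G r →
       Θ⊗Θ (δ r G) ≋ bind (Θ G) (δac r))
    -- compatibility with the counits
    × ((G : MG N) → WF G → bind (Θ G) εΔ ≋ εΔ G)
    × ((G : MG N) → WF G → bind (Θ G) εδ ≋ εδ G)
theorem4p2 N =
    (λ G H wfG wfH disjoint → Θ-· wfG wfH disjoint)
  , Θ-edgeless (refl , refl)
  , (λ G I J wf partition → Θ-Δ wf partition)
    -- the bijection for δ works for any labelling r of the classes
  , (λ G r wf _ → Θ-δ r wf)
  , (λ G wf → bind-Θ-εΔ wf)
  , (λ G _ → bind-Θ-εδ)
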